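{- Let $k\ge1$ be an integer and $\{U_n(k)\}_{n\ge0}$ defined by $U_0(k)=0$, $U_1(k)=1$, $U_{n+2}(k)=(4k+2)U_{n+1}(k)-U_n(k)$. For a positive integer $m$ let $z(m)$ be the smallest $n\ge1$ with $m\mid U_n(k)$, and for $n\ge1$ let $\mathcal D_k(n)$ be the smallest positive integer $m$ such that $U_0(k),\ldots,U_{n-1}(k)$ are pairwise incongruent modulo $m$. Let $p\ge3$ be an odd prime, $b\ge1$, and $m=p^bm_1$ with $m_1$ a positive integer, $p\nmid m_1$. If $z(p^b)\mid p^{b-1}$, then $m$ is not a discriminator value, i.e. $m\ne\mathcal D_k(n)$ for every $n\ge1$. -}

module Defs where

open import Data.Nat as ℕ using (ℕ; zero; suc; _<_; _≤_)
open import Data.Integer as ℤ using (ℤ; +_; _-_; _*_)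
open import Data.Integer.Divisibility using () renaming (_∣_ to _∣ℤ_)
open import Data.Product using (_×_)
open import Relation.Nullary using (¬_)

U : ℕ → ℕ → ℤ
U k zero = + 0
U k (suc zero) = + 1
U k (suc (suc n)) = (+ (4 ℕ.* k ℕ.+ 2)) * U k (suc n) - U k n

IsZ : ℕ → ℕ → ℕ → Set
IsZ k m n =
  1 ≤ n × (+ m) ∣ℤ U k n × (∀ n′ → 1 ≤ n′ → (+ m) ∣ℤ U k n′ → n ≤ n′)

Incongruent : ℕ → ℕ → ℕ → Set
Incongruent k n m = ∀ i j → i < n → j < n → i < j → ¬ ((+ m) ∣ℤ (U k i - U k j))

IsDiscriminator : ℕ → ℕ → ℕ → Set
IsDiscriminator k n m =
  1 ≤ m × Incongruent k n m × (∀ m′ → 1 ≤ m′ → Incongruent k n m′ → m ≤ m′)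

module Submission where

-- Write m = p^b·m₁ and suppose m = 𝒟_k(n).
--  (1) An upper bound on n.  Let z = z(p^b).  By the addition formula
--      U_{a+c+1} = U_{a+1}U_{c+1} − U_a U_c, p^b divides U_{cz} for every c.
--      Among the m₁+1 indices 0, z, …, m₁z two are congruent modulo m₁
--      (pigeonhole), hence modulo p^b·m₁ (coprimality); since U_0,…,U_{n−1}
--      are incongruent modulo m, this forces n ≤ m₁z ≤ m₁p^{b−1} =: T.
--  (2) Powers of two discriminate.  For M = 2^e, U_M and U_{M+1} − 1 are
--      odd multiples of M (induction on e via the doubling formulas), hence
--      so is U_{j+M} − U_j for every j; it follows that 2^e separates
--      U_0,…,U_{2^e−1}.
--  (3) Choosing 2^f with n ≤ 2^f < 2n, minimality of m gives
--      m ≤ 2^f < 2n ≤ 2T < 3T ≤ p·T = m, a contradiction.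

open import Defs
open import Data.Nat as ℕ using (ℕ; zero; suc; NonZero)
open import Data.Integer as ℤ using (ℤ; +_)
open import Data.Product using (Σ; ∃; _×_; _,_; proj₁; proj₂)
open import Relation.Binary.PropositionalEquality
open import Relation.Nullary using (¬_; yes; no)

module _ where
  open import Data.Integer using (_+_; _-_; _*_; -_)
  open import Data.Integer.Properties using (pos-*; pos-+; +-identityʳ; *-cancelˡ-≡)
  open import Data.Integer.Divisibility.Signed
  import Data.Nat.Properties as ℕP
  open import Data.Nat using (_<_; _≤_; z<s; s≤s)
  open import Data.Integer.DivMod using (_%ℕ_; _/ℕ_; a≡a%ℕn+[a/ℕn]*n)
  open import Data.Nat.Divisibility using (∣1⇒≡1; n∣m*n)
  open import Data.Integer.Tactic.RingSolver using (solve-∀)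
  import Data.Nat.Tactic.RingSolver as ℕRing
  open ≡-Reasoning

  P : ℕ → ℤ
  P k = + (4 ℕ.* k ℕ.+ 2)

  -- P is twice an odd number; this drives all the 2-adic computations.
  P≡2[2k+1] : ∀ k → P k ≡ + 2 * (+ 2 * + k + + 1)
  P≡2[2k+1] k = begin
    + (4 ℕ.* k ℕ.+ 2)          ≡⟨ cong +_ (double k) ⟩
    + (2 ℕ.* (2 ℕ.* k ℕ.+ 1))  ≡⟨ pos-* 2 (2 ℕ.* k ℕ.+ 1) ⟩
    + 2 * + (2 ℕ.* k ℕ.+ 1)    ≡⟨ cong (+ 2 *_) (pos-+ (2 ℕ.* k) 1) ⟩
    + 2 * (+ (2 ℕ.* k) + + 1)  ≡⟨ cong (λ x → + 2 * (x + + 1)) (pos-* 2 k) ⟩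
    + 2 * (+ 2 * + k + + 1)    ∎
    where
    double : ∀ k → 4 ℕ.* k ℕ.+ 2 ≡ 2 ℕ.* (2 ℕ.* k ℕ.+ 1)
    double = ℕRing.solve-∀

  U-add : ∀ k m n → U k (suc (m ℕ.+ n)) ≡ U k (suc m) * U k (suc n) - U k m * U k n
  U-add k zero n = base (U k (suc n)) (U k n)
    where
    base : ∀ x y → x ≡ + 1 * x - + 0 * y
    base = solve-∀
  U-add k (suc zero) n = base (P k) (U k (suc n)) (U k n)
    where
    base : ∀ p x y → p * x - y ≡ (p * + 1 - + 0) * x - + 1 * y
    base = solve-∀
  U-add k (suc (suc m)) n = begin
    P k * U k (suc (suc m ℕ.+ n)) - U k (suc (m ℕ.+ n))
      ≡⟨ cong₂ (λ a b → P k * a - b) (U-add k (suc m) n) (U-add k m n) ⟩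
    P k * (U₂ * V₁ - U₁ * V₀) - (U₁ * V₁ - U₀ * V₀)
      ≡⟨ regroup (P k) U₀ U₁ U₂ V₀ V₁ ⟩
    (P k * U₂ - U₁) * V₁ - (P k * U₁ - U₀) * V₀ ∎
    where
    U₀ = U k m; U₁ = U k (suc m); U₂ = U k (suc (suc m))
    V₀ = U k n; V₁ = U k (suc n)
    regroup : ∀ p a₀ a₁ a₂ b₀ b₁ →
      p * (a₂ * b₁ - a₁ * b₀) - (a₁ * b₁ - a₀ * b₀) ≡ (p * a₂ - a₁) * b₁ - (p * a₁ - a₀) * b₀
    regroup = solve-∀

  U-backwards : ∀ k n → U k n ≡ P k * U k (suc n) - U k (suc (suc n))
  U-backwards k n = cancel (P k) (U k (suc n)) (U k n)
    where
    cancel : ∀ p x w → w ≡ p * x - (p * x - w)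
    cancel = solve-∀

  -- Doubling formula U_{2n} = U_n (2U_{n+1} − P U_n): combine the backward recurrence with
  -- the addition formula for U_{2n+1} and U_{2n+2}.
  U-double : ∀ k n → U k (n ℕ.+ n) ≡ U k n * (+ 2 * U k (suc n) - P k * U k n)
  U-double k n = begin
    U k (n ℕ.+ n)
      ≡⟨ U-backwards k (n ℕ.+ n) ⟩
    P k * U k (suc (n ℕ.+ n)) - U k (suc (suc (n ℕ.+ n)))
      ≡⟨ cong₂ (λ x y → P k * x - y) (U-add k n n) U-2n+2 ⟩
    P k * (b * b - a * a) - (b * (P k * b - a) - a * b)
      ≡⟨ simplify (P k) a b ⟩
    a * (+ 2 * b - P k * a) ∎
    where
    a = U k n; b = U k (suc n)
    U-2n+2 : U k (suc (suc (n ℕ.+ n))) ≡ b * (P k * b - a) - a * b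
    U-2n+2 = trans (cong (λ i → U k (suc i)) (sym (ℕP.+-suc n n))) (U-add k n (suc n))
    simplify : ∀ p a b → p * (b * b - a * a) - (b * (p * b - a) - a * b) ≡ a * (+ 2 * b - p * a)
    simplify = solve-∀

  OddMultiple : ℕ → ℤ → Set
  OddMultiple M x = Σ ℤ λ r → x ≡ + M * (+ 2 * r + + 1)

  -- Since P is even, odd multiples of M are preserved by the step (x, y) ↦ P·y − x.
  oddMultiple-step : ∀ k {M x y} → OddMultiple M x → OddMultiple M y → OddMultiple M (P k * y - x)
  oddMultiple-step k {M} (r₀ , refl) (r₁ , refl) = (+ 2 * + k + + 1) * (+ 2 * r₁ + + 1) - r₀ - + 1 , (begin
    P k * (+ M * (+ 2 * r₁ + + 1)) - + M * (+ 2 * r₀ + + 1)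
      ≡⟨ cong (λ p → p * (+ M * (+ 2 * r₁ + + 1)) - + M * (+ 2 * r₀ + + 1)) (P≡2[2k+1] k) ⟩
    + 2 * (+ 2 * + k + + 1) * (+ M * (+ 2 * r₁ + + 1)) - + M * (+ 2 * r₀ + + 1)
      ≡⟨ regroup (+ k) (+ M) r₀ r₁ ⟩
    + M * (+ 2 * ((+ 2 * + k + + 1) * (+ 2 * r₁ + + 1) - r₀ - + 1) + + 1) ∎)
    where
    regroup : ∀ K X r₀ r₁ → + 2 * (+ 2 * K + + 1) * (X * (+ 2 * r₁ + + 1)) - X * (+ 2 * r₀ + + 1)
              ≡ X * (+ 2 * ((+ 2 * K + + 1) * (+ 2 * r₁ + + 1) - r₀ - + 1) + + 1)
    regroup = solve-∀

  oddMultiple⇒∣ : ∀ {M x} → OddMultiple M x → + M ∣ x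
  oddMultiple⇒∣ {M} (r , refl) = ∣m⇒∣m*n (+ 2 * r + + 1) ∣-refl

  odd-not-even : ∀ r → ¬ (+ 2 ∣ (+ 2 * r + + 1))
  odd-not-even r 2∣odd with ∣1⇒≡1 (∣⇒∣ᵤ (∣m+n∣m⇒∣n 2∣odd (∣m⇒∣m*n r ∣-refl)))
  ... | ()

  oddMultiple⇒∤ : ∀ {M x} .{{_ : NonZero M}} → OddMultiple M x → ¬ (+ (2 ℕ.* M) ∣ x)
  oddMultiple⇒∤ {M} (r , refl) (divides q eq) = odd-not-even r (divides q 2r+1≡q*2)
    where
    2r+1≡q*2 : + 2 * r + + 1 ≡ q * + 2
    2r+1≡q*2 = *-cancelˡ-≡ (+ M) _ _ (trans eq (trans (cong (q *_) (pos-* 2 M)) (swap q (+ M))))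
      where
      swap : ∀ q X → q * (+ 2 * X) ≡ X * (q * + 2)
      swap = solve-∀

  TwoAdicShape : ℕ → ℕ → Set
  TwoAdicShape k M = OddMultiple M (U k M) × OddMultiple M (U k (suc M) - + 1)

  -- Cofactors of M + M are found by computing in terms of X = +M.
  oddMultiple-twice : ∀ {M x} r → x ≡ (+ M + + M) * (+ 2 * r + + 1) → OddMultiple (M ℕ.+ M) x
  oddMultiple-twice {M} r eq = r , trans eq (cong (_* (+ 2 * r + + 1)) (sym (pos-+ M M)))

  U-suc-shape : ∀ {k M} t → U k (suc M) - + 1 ≡ + M * (+ 2 * t + + 1)
              → U k (suc M) ≡ + M * (+ 2 * t + + 1) + + 1
  U-suc-shape {k} {M} t eq = trans (sym (minus-plus (U k (suc M)))) (cong (_+ + 1) eq)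
    where
    minus-plus : ∀ b → b - + 1 + + 1 ≡ b
    minus-plus = solve-∀

  -- With U_M = M(2s+1) and U_{M+1} = M(2t+1) + 1, U_{2M} = U_M (2U_{M+1} − P U_M) is
  -- 2M(2s+1)(1 + 2Mw) for w = t − 2ks − k − s, an odd multiple of 2M.
  shape-double-even : ∀ k M → TwoAdicShape k M → OddMultiple (M ℕ.+ M) (U k (M ℕ.+ M))
  shape-double-even k M ((s , Uₘ) , (t , Uₘ₊₁)) =
    oddMultiple-twice {M} (s + X * (t - + 2 * K * s - K - s) * (+ 2 * s + + 1)) (begin
      U k (M ℕ.+ M)
        ≡⟨ U-double k M ⟩
      U k M * (+ 2 * U k (suc M) - P k * U k M)
        ≡⟨ cong₃ Uₘ (U-suc-shape {k} {M} t Uₘ₊₁) (P≡2[2k+1] k) ⟩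
      X * (+ 2 * s + + 1) * (+ 2 * (X * (+ 2 * t + + 1) + + 1) - + 2 * (+ 2 * K + + 1) * (X * (+ 2 * s + + 1)))
        ≡⟨ identity K X s t ⟩
      (X + X) * (+ 2 * (s + X * (t - + 2 * K * s - K - s) * (+ 2 * s + + 1)) + + 1) ∎)
    where
    X = + M; K = + k
    cong₃ : ∀ {a a′ b b′ p p′} → a ≡ a′ → b ≡ b′ → p ≡ p′ → a * (+ 2 * b - p * a) ≡ a′ * (+ 2 * b′ - p′ * a′)
    cong₃ refl refl refl = refl
    identity : ∀ K X s t →
      X * (+ 2 * s + + 1) * (+ 2 * (X * (+ 2 * t + + 1) + + 1) - + 2 * (+ 2 * K + + 1) * (X * (+ 2 * s + + 1)))
      ≡ (X + X) * (+ 2 * (s + X * (t - + 2 * K * s - K - s) * (+ 2 * s + + 1)) + + 1)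
    identity = solve-∀

  -- Likewise U_{2M+1} − 1 = U_{M+1}² − U_M² − 1 = 2M(2t + 1 + 2M(t² + t − s² − s)).
  shape-double-odd : ∀ k M → TwoAdicShape k M → OddMultiple (M ℕ.+ M) (U k (suc (M ℕ.+ M)) - + 1)
  shape-double-odd k M ((s , Uₘ) , (t , Uₘ₊₁)) =
    oddMultiple-twice {M} (t + X * (t * t + t - s * s - s)) (begin
      U k (suc (M ℕ.+ M)) - + 1
        ≡⟨ cong (_- + 1) (U-add k M M) ⟩
      U k (suc M) * U k (suc M) - U k M * U k M - + 1
        ≡⟨ cong₂ (λ a b → b * b - a * a - + 1) Uₘ (U-suc-shape {k} {M} t Uₘ₊₁) ⟩
      (X * (+ 2 * t + + 1) + + 1) * (X * (+ 2 * t + + 1) + + 1) - X * (+ 2 * s + + 1) * (X * (+ 2 * s + + 1)) - + 1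
        ≡⟨ identity X s t ⟩
      (X + X) * (+ 2 * (t + X * (t * t + t - s * s - s)) + + 1) ∎)
    where
    X = + M
    identity : ∀ X s t →
      (X * (+ 2 * t + + 1) + + 1) * (X * (+ 2 * t + + 1) + + 1) - X * (+ 2 * s + + 1) * (X * (+ 2 * s + + 1)) - + 1
      ≡ (X + X) * (+ 2 * (t + X * (t * t + t - s * s - s)) + + 1)
    identity = solve-∀

  shape-double : ∀ k M → TwoAdicShape k M → TwoAdicShape k (2 ℕ.* M)
  shape-double k M shape = subst (TwoAdicShape k) (cong (M ℕ.+_) (sym (ℕP.+-identityʳ M)))
                                 (shape-double-even k M shape , shape-double-odd k M shape)

  -- Every power of two has the 2-adic shape; at M = 1, U_1 = 1 and U_2 − 1 = 4k + 1.
  shape-pow2 : ∀ k e → TwoAdicShape k (2 ℕ.^ e)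
  shape-pow2 k zero = (+ 0 , refl) , (+ 2 * + k , base)
    where
    base : P k * + 1 - + 0 - + 1 ≡ + 1 * (+ 2 * (+ 2 * + k) + + 1)
    base = trans (cong (λ p → p * + 1 - + 0 - + 1) (P≡2[2k+1] k)) (identity (+ k))
      where
      identity : ∀ K → + 2 * (+ 2 * K + + 1) * + 1 - + 0 - + 1 ≡ + 1 * (+ 2 * (+ 2 * K) + + 1)
      identity = solve-∀
  shape-pow2 k (suc e) = shape-double k (2 ℕ.^ e) (shape-pow2 k e)

  -- Under the shape at M, every difference U_{j+M} − U_j is an odd multiple of M:
  -- these differences obey the recurrence and start with U_M and U_{M+1} − 1.
  shift-oddMultiple : ∀ k M → TwoAdicShape k M → ∀ j → OddMultiple M (U k (j ℕ.+ M) - U k j)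
  shift-oddMultiple k M (Uₘ , Uₘ₊₁) zero = subst (OddMultiple M) (sym (+-identityʳ (U k M))) Uₘ
  shift-oddMultiple k M (Uₘ , Uₘ₊₁) (suc zero) = Uₘ₊₁
  shift-oddMultiple k M shape (suc (suc j)) =
    subst (OddMultiple M) (sym (regroup (P k) (U k (suc j ℕ.+ M)) (U k (j ℕ.+ M)) (U k (suc j)) (U k j)))
      (oddMultiple-step k {M} (shift-oddMultiple k M shape j) (shift-oddMultiple k M shape (suc j)))
    where
    regroup : ∀ p a b c d → (p * a - b) - (p * c - d) ≡ p * (a - c) - (b - d)
    regroup = solve-∀

  -- For d ≥ 2^{e−1}
  -- write d = 2^{e−1} + o: the difference splits into an odd multiple of 2^{e−1} (the
  -- shift by 2^{e−1}) plus the difference at gap o, which is handled by induction.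
  pow2-separates : ∀ k e i d → 0 < d → d < 2 ℕ.^ e → ¬ (+ (2 ℕ.^ e) ∣ (U k (i ℕ.+ d) - U k i))
  pow2-separates k zero i (suc _) _ (s≤s ())
  pow2-separates k (suc e) i d 0<d d<2M 2M∣ with d ℕP.<? 2 ℕ.^ e
  ... | yes d<M = pow2-separates k e i d 0<d d<M (∣-trans M∣2M 2M∣)
    where
    M∣2M : + (2 ℕ.^ e) ∣ + (2 ℕ.* 2 ℕ.^ e)
    M∣2M = ∣ᵤ⇒∣ (n∣m*n 2)
  ... | no d≮M with ℕP.m≤n⇒∃[o]m+o≡n (ℕP.≮⇒≥ d≮M)
  ...   | zero , refl =
    oddMultiple⇒∤ {{ℕP.m^n≢0 2 e}} (shift-oddMultiple k M (shape-pow2 k e) i)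
      (subst (λ g → + (2 ℕ.* M) ∣ (U k (i ℕ.+ g) - U k i)) (ℕP.+-identityʳ M) 2M∣)
    where
    M = 2 ℕ.^ e
  ...   | suc o , refl =
    pow2-separates k e i (suc o) z<s o<M
      (∣m+n∣m⇒∣n (∣-trans M∣2M (subst (+ (2 ℕ.* M) ∣_) split 2M∣))
                 (oddMultiple⇒∣ (shift-oddMultiple k M (shape-pow2 k e) (i ℕ.+ suc o))))
    where
    M = 2 ℕ.^ e
    M∣2M : + M ∣ + (2 ℕ.* M)
    M∣2M = ∣ᵤ⇒∣ (n∣m*n 2)
    o<M : suc o < M
    o<M = subst (suc o <_) (ℕP.+-identityʳ M) (ℕP.+-cancelˡ-< M (suc o) (M ℕ.+ 0) d<2M)
    split : U k (i ℕ.+ (M ℕ.+ suc o)) - U k i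
          ≡ (U k ((i ℕ.+ suc o) ℕ.+ M) - U k (i ℕ.+ suc o)) + (U k (i ℕ.+ suc o) - U k i)
    split = trans (cong (λ g → U k g - U k i) reindex) (telescope (U k ((i ℕ.+ suc o) ℕ.+ M)) (U k (i ℕ.+ suc o)) (U k i))
      where
      reindex : i ℕ.+ (M ℕ.+ suc o) ≡ (i ℕ.+ suc o) ℕ.+ M
      reindex = trans (cong (i ℕ.+_) (ℕP.+-comm M (suc o))) (sym (ℕP.+-assoc i (suc o) M))
      telescope : ∀ x y z → x - z ≡ (x - y) + (y - z)
      telescope = solve-∀

  pow2-incongruent : ∀ k e n → n ≤ 2 ℕ.^ e → Incongruent k n (2 ℕ.^ e)
  pow2-incongruent k e n n≤2^e i j i<n j<n i<j 2^e∣Uᵢ-Uⱼ with ℕP.m≤n⇒∃[o]m+o≡n i<j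
  ... | o , refl =
    pow2-separates k e i (suc o) z<s gap<2^e
      (subst (λ g → + (2 ℕ.^ e) ∣ (U k g - U k i)) (sym (ℕP.+-suc i o))
        (subst (+ (2 ℕ.^ e) ∣_) (negate (U k i) (U k j)) (∣m⇒∣-m (∣ᵤ⇒∣ 2^e∣Uᵢ-Uⱼ))))
    where
    gap<2^e : suc o < 2 ℕ.^ e
    gap<2^e = ℕP.≤-<-trans (s≤s (ℕP.m≤n+m o i)) (ℕP.<-≤-trans j<n n≤2^e)
    negate : ∀ a b → - (a - b) ≡ b - a
    negate = solve-∀

  -- If d divides U_z then it divides every U_{cz}, by U_{z+cz} = U_z U_{cz+1} − U_{z−1} U_{cz}.
  ∣U-multiples : ∀ k z {d} → d ∣ U k (suc z) → ∀ c → d ∣ U k (c ℕ.* suc z)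
  ∣U-multiples k z d∣U_z zero = divides (+ 0) refl
  ∣U-multiples k z d∣U_z (suc c) =
    subst (_ ∣_) (sym (U-add k z (c ℕ.* suc z)))
      (∣m∣n⇒∣m-n (∣m⇒∣m*n _ d∣U_z) (∣n⇒∣m*n (U k z) (∣U-multiples k z d∣U_z c)))

  %ℕ-equal⇒∣ : ∀ m .{{_ : NonZero m}} a b → a %ℕ m ≡ b %ℕ m → + m ∣ (a - b)
  %ℕ-equal⇒∣ m a b same = divides (a /ℕ m - b /ℕ m) (begin
    a - b
      ≡⟨ cong₂ _-_ (a≡a%ℕn+[a/ℕn]*n a m) (a≡a%ℕn+[a/ℕn]*n b m) ⟩
    (+ (a %ℕ m) + (a /ℕ m) * + m) - (+ (b %ℕ m) + (b /ℕ m) * + m)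
      ≡⟨ cong (λ r → (+ (a %ℕ m) + (a /ℕ m) * + m) - (+ r + (b /ℕ m) * + m)) (sym same) ⟩
    (+ (a %ℕ m) + (a /ℕ m) * + m) - (+ (a %ℕ m) + (b /ℕ m) * + m)
      ≡⟨ cancel (+ (a %ℕ m)) (a /ℕ m) (b /ℕ m) (+ m) ⟩
    (a /ℕ m - b /ℕ m) * + m ∎)
    where
    cancel : ∀ r qa qb x → (r + qa * x) - (r + qb * x) ≡ (qa - qb) * x
    cancel = solve-∀

open import Data.Nat using (_≤_; _<_; _*_; _^_; _∸_; _+_; z≤n; >-nonZero)
open import Data.Nat.Properties
open import Data.Nat.Divisibility using (_∣_; divides; ∣-trans; ∣1⇒≡1; ∣⇒≤)
open import Data.Nat.Coprimality using (Coprime; coprime-divisor)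
open import Data.Nat.Primality using (Prime; prime⇒irreducible; prime⇒nonZero)
open import Data.Integer.Divisibility.Signed using (∣⇒∣ᵤ; ∣ᵤ⇒∣; ∣m∣n⇒∣m-n) renaming (_∣_ to _∣ᶻ_)
open import Data.Integer.DivMod using (_%ℕ_; n%ℕd<d)
open import Data.Fin using (Fin; toℕ; fromℕ<)
open import Data.Fin.Properties using (pigeonhole; toℕ≤pred[n]; toℕ-fromℕ<)
open import Data.Sum using (inj₁; inj₂)
open import Data.Empty using (⊥-elim)

prime∤⇒coprime : ∀ {p m} → Prime p → ¬ (p ∣ m) → Coprime m p
prime∤⇒coprime p-prime p∤m (d∣m , d∣p) with prime⇒irreducible p-prime d∣p
... | inj₁ d≡1 = d≡1
... | inj₂ refl = ⊥-elim (p∤m d∣m)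

coprime-^ : ∀ {m p} → Coprime m p → ∀ b → Coprime m (p ^ b)
coprime-^ c zero (_ , d∣1) = ∣1⇒≡1 d∣1
coprime-^ c (suc b) (d∣m , d∣p*pᵇ) =
  coprime-^ c b (d∣m , coprime-divisor (λ (e∣d , e∣p) → c (∣-trans e∣d d∣m , e∣p)) d∣p*pᵇ)

coprime-*-∣ : ∀ {m M x} → Coprime m M → m ∣ x → M ∣ x → M * m ∣ x
coprime-*-∣ {m} {M} c m∣qM (divides q refl) with coprime-divisor c (subst (m ∣_) (*-comm q M) m∣qM)
... | divides r refl = divides r (trans (*-assoc r m M) (cong (r *_) (*-comm m M)))

multiples-collide : ∀ k m₁ .{{_ : NonZero m₁}} z →
  ∃ λ c₁ → ∃ λ c₂ → c₁ < c₂ × c₂ ≤ m₁ × + m₁ ∣ᶻ (U k (c₁ * z) ℤ.- U k (c₂ * z))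
multiples-collide k m₁ z with pigeonhole (n<1+n m₁) residue
  where
  residue : Fin (suc m₁) → Fin m₁
  residue c = fromℕ< (n%ℕd<d (U k (toℕ c * z)) m₁)
... | c₁ , c₂ , c₁<c₂ , same =
  toℕ c₁ , toℕ c₂ , c₁<c₂ , toℕ≤pred[n] c₂ , %ℕ-equal⇒∣ m₁ (U k (toℕ c₁ * z)) (U k (toℕ c₂ * z)) same-residue
  where
  same-residue : U k (toℕ c₁ * z) %ℕ m₁ ≡ U k (toℕ c₂ * z) %ℕ m₁
  same-residue = trans (sym (toℕ-fromℕ< _)) (trans (cong toℕ same) (toℕ-fromℕ< _))

-- If M ∣ U_z with z ≥ 1 and m₁ is coprime to M, then U_0, …, U_{n−1} can be pairwise
-- incongruent modulo M·m₁ only if n ≤ m₁z: otherwise two of the multiples U_{cz} (c ≤ m₁),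
-- all divisible by M, would agree modulo m₁ and hence modulo M·m₁.
incongruent⇒bound : ∀ k n z M m₁ .{{_ : NonZero m₁}} → + M ∣ᶻ U k (suc z) → Coprime m₁ M
                  → Incongruent k n (M * m₁) → n ≤ m₁ * suc z
incongruent⇒bound k n z M m₁ M∣U_z coprime incongruent with n ≤? m₁ * suc z
... | yes n≤m₁z = n≤m₁z
... | no n≰m₁z with multiples-collide k m₁ (suc z)
...   | c₁ , c₂ , c₁<c₂ , c₂≤m₁ , m₁∣diff =
  ⊥-elim (incongruent a b a<n b<n a<b (coprime-*-∣ coprime (∣⇒∣ᵤ m₁∣diff) (∣⇒∣ᵤ M∣diff)))
  where
  a = c₁ * suc z; b = c₂ * suc z
  a<b : a < b
  a<b = *-monoˡ-< (suc z) c₁<c₂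
  b<n : b < n
  b<n = ≤-<-trans (*-monoˡ-≤ (suc z) c₂≤m₁) (≰⇒> n≰m₁z)
  a<n : a < n
  a<n = <-trans a<b b<n
  M∣diff : + M ∣ᶻ (U k a ℤ.- U k b)
  M∣diff = ∣m∣n⇒∣m-n (∣U-multiples k z M∣U_z c₁) (∣U-multiples k z M∣U_z c₂)

n≤2^n : ∀ n → n ≤ 2 ^ n
n≤2^n zero = z≤n
n≤2^n (suc n) = subst (suc n ≤_) (cong (λ x → 2 ^ n + x) (sym (+-identityʳ (2 ^ n))))
                  (+-mono-≤ (m^n>0 2 n) (n≤2^n n))

pow2-bracket : ∀ n → 1 ≤ n → ∃ λ f → n ≤ 2 ^ f × 2 ^ f < 2 * n
pow2-bracket n 1≤n = descend n (n≤2^n n)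
  where
  descend : ∀ e → n ≤ 2 ^ e → ∃ λ f → n ≤ 2 ^ f × 2 ^ f < 2 * n
  descend zero n≤1 = 0 , n≤1 , *-monoʳ-≤ 2 1≤n
  descend (suc e) n≤2^e+1 with n ≤? 2 ^ e
  ... | yes n≤2^e = descend e n≤2^e
  ... | no n≰2^e = suc e , n≤2^e+1 , *-monoʳ-< 2 (≰⇒> n≰2^e)

-- Let m = p^b·m₁ = p·T with T = m₁·p^{b−1}.
lemma13 : (k : ℕ) → 1 ≤ k → (p b m₁ : ℕ) → Prime p → 3 ≤ p → 1 ≤ b → 1 ≤ m₁ → ¬ (p ∣ m₁)
    → (z : ℕ) → IsZ k (p ^ b) z → z ∣ p ^ (b ∸ 1)
    → ∀ n → 1 ≤ n → ¬ IsDiscriminator k n (p ^ b * m₁)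
lemma13 k _ p (suc b) m₁ p-prime 3≤p _ 1≤m₁ p∤m₁ (suc z) (_ , p^b∣U_z , _) z∣p^[b-1] n 1≤n
        (_ , incongruent , minimal) =
  <⇒≱ 2^f<m (minimal (2 ^ f) (m^n>0 2 f) (pow2-incongruent k f n n≤2^f))
  where
  instance
    p≢0 : NonZero p
    p≢0 = prime⇒nonZero p-prime
    m₁≢0 : NonZero m₁
    m₁≢0 = >-nonZero 1≤m₁
  T = m₁ * p ^ b
  n≤T : n ≤ T
  n≤T = ≤-trans (incongruent⇒bound k n z (p ^ suc b) m₁ (∣ᵤ⇒∣ p^b∣U_z)
                   (coprime-^ (prime∤⇒coprime p-prime p∤m₁) (suc b)) incongruent)
                (*-monoʳ-≤ m₁ (∣⇒≤ {{m^n≢0 p b}} z∣p^[b-1]))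
  instance
    T≢0 : NonZero T
    T≢0 = >-nonZero (≤-trans 1≤n n≤T)
  f = proj₁ (pow2-bracket n 1≤n)
  n≤2^f : n ≤ 2 ^ f
  n≤2^f = proj₁ (proj₂ (pow2-bracket n 1≤n))
  2^f<m : 2 ^ f < p ^ suc b * m₁
  2^f<m = begin-strict
    2 ^ f  <⟨ proj₂ (proj₂ (pow2-bracket n 1≤n)) ⟩
    2 * n  ≤⟨ *-monoʳ-≤ 2 n≤T ⟩
    2 * T  <⟨ *-monoˡ-< T (n<1+n 2) ⟩
    3 * T  ≤⟨ *-monoˡ-≤ T 3≤p ⟩
    p * T  ≡⟨ cong (p *_) (*-comm m₁ (p ^ b)) ⟩
    p * (p ^ b * m₁)  ≡⟨ *-assoc p (p ^ b) m₁ ⟨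
    p ^ suc b * m₁ ∎
    where open ≤-Reasoning
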